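{- For every $n\ge1$ there exists a bijection between the set of ordered set partitions of $\{1,\ldots,n\}$ and the set of standard composite set partitions of $\{1,\ldots,n\}$.
   Context: An ordered set partition of a set $J$ is a sequence $(S_1,\ldots,S_k)$ of nonempty pairwise disjoint subsets with union $J$. A composite set partition of $\{1,\ldots,n\}$ is a set $\{\mathbf{S}_1,\ldots,\mathbf{S}_l\}$ where each $\mathbf{S}_i$ is an ordered set partition of a subset $J_i\subseteq\{1,\ldots,n\}$ and $\{J_1,\ldots,J_l\}$ is an (unordered) set partition of $\{1,\ldots,n\}$. It is standard if for each $i$ the first block of $\mathbf{S}_i$ contains $\min J_i$. -}

module Defs where

open import Data.Nat using (ℕ)
open import Data.Fin using (Fin; _≤_)
open import Data.Fin.Subset using (Subset; _∈_; _∩_; _∪_; ⊥; ⊤; Nonempty)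
open import Data.List using (List; []; _∷_; foldr; map)
open import Data.List.Relation.Unary.All using (All)
open import Data.List.Relation.Unary.AllPairs using (AllPairs)
open import Data.List.Relation.Binary.Permutation.Propositional using (_↭_; ↭-isEquivalence)
open import Data.Product using (Σ; _×_; proj₁)
open import Data.Unit using () renaming (⊤ to Unit)
open import Relation.Binary using (Setoid)
open import Relation.Binary.PropositionalEquality using (_≡_; isEquivalence)
import Relation.Binary.Construct.On as On

-- Elements of {1,…,n} are represented by Fin n (i ↦ i+1), order preserved.

⋃ : ∀ {n} → List (Subset n) → Subset n
⋃ = foldr _∪_ ⊥

Disjoint : ∀ {n} → Subset n → Subset n → Set
Disjoint A B = A ∩ B ≡ ⊥

IsOrderedSetPartition : ∀ {n} → Subset n → List (Subset n) → Set
IsOrderedSetPartition J Ss = All Nonempty Ss × AllPairs Disjoint Ss × ⋃ Ss ≡ J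

IsMin : ∀ {n} → Subset n → Fin n → Set
IsMin J m = m ∈ J × (∀ x → x ∈ J → m ≤ x)

FirstBlockHasMin : ∀ {n} → List (Subset n) → Set
FirstBlockHasMin [] = Unit
FirstBlockHasMin (S ∷ Ss) = ∀ m → IsMin (⋃ (S ∷ Ss)) m → m ∈ S

-- The list is considered up to
-- permutation (see CSP-setoid), modelling an unordered set.
IsCompositeSetPartition : ∀ {n} → List (List (Subset n)) → Set
IsCompositeSetPartition {n} 𝐒s =
  All (λ 𝐒 → IsOrderedSetPartition (⋃ 𝐒) 𝐒) 𝐒s
  × All (λ 𝐒 → Nonempty (⋃ 𝐒)) 𝐒s
  × AllPairs (λ 𝐒 𝐓 → Disjoint (⋃ 𝐒) (⋃ 𝐓)) 𝐒s
  × ⋃ (map ⋃ 𝐒s) ≡ ⊤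

IsStandard : ∀ {n} → List (List (Subset n)) → Set
IsStandard 𝐒s = All FirstBlockHasMin 𝐒s

OSP : ℕ → Set
OSP n = Σ (List (Subset n)) (IsOrderedSetPartition ⊤)

SCSP : ℕ → Set
SCSP n = Σ (List (List (Subset n))) (λ 𝐒s → IsCompositeSetPartition 𝐒s × IsStandard 𝐒s)

OSP-setoid : ℕ → Setoid _ _
OSP-setoid n = record
  { Carrier = OSP n
  ; _≈_ = λ x y → proj₁ x ≡ proj₁ y
  ; isEquivalence = On.isEquivalence proj₁ isEquivalence
  }

SCSP-setoid : ℕ → Setoid _ _
SCSP-setoid n = record
  { Carrier = SCSP n
  ; _≈_ = λ x y → proj₁ x ↭ proj₁ y
  ; isEquivalence = On.isEquivalence proj₁ ↭-isEquivalence
  }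

module Submission where

-- Call a block of an ordered set partition (B₁,…,B_k) a record if its
-- minimum is smaller than the minima of all earlier blocks.  Cutting the
-- sequence in front of every record splits it into segments.  Each segment
-- is an ordered set partition whose first block carries the least minimum
-- of the segment, so the segments form a standard composite set partition;
-- moreover the minima of the segments strictly decrease along the list.
-- Conversely, listing the components of a standard composite set partition
-- by decreasing minimum and concatenating them gives an ordered set
-- partition whose cutting returns exactly these components.

open import Defs
open import Data.Nat using (ℕ; _≤_)
open import Function.Bundles using (Bijection)

open import Data.Nat using (zero; suc; _<_; _<?_; _⊓_; z≤n; s≤s)
open import Data.Nat.Properties
  using ( ≤-refl; ≤-trans; ≤-antisym; <⇒≤; ≤-<-trans; ≤⇒≯; ≮⇒≥; ≤∧≢⇒<; <-irrefl; <-asym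
        ; ⊓-glb; m⊓n≤m; m⊓n≤n; ≤-decTotalOrder)
open import Data.Bool using (true; false)
open import Data.Empty using (⊥; ⊥-elim)
open import Data.Fin using (Fin; zero; suc; toℕ)
open import Data.Fin.Properties using (toℕ-injective)
open import Data.Fin.Subset using (Subset; _∈_; _∪_; Nonempty; ⊤) renaming (⊥ to ∅)
open import Data.Fin.Subset.Properties
  using (∉⊥; x∈p∩q⁺; x∈p∩q⁻; x∈p∪q⁺; x∈p∪q⁻; Empty-unique; ∩-comm; ∪-assoc; ∪-identityˡ
        ; ∪-isCommutativeMonoid)
open import Data.Vec using ([]; _∷_; here; there)
open import Data.List using (List; []; _∷_; [_]; _++_; concat; map)
open import Data.List.Properties using (++-assoc; ++-identityʳ)
open import Data.List.Membership.Propositional using () renaming (_∈_ to _∈ₗ_)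
open import Data.List.Relation.Unary.All as All using (All; []; _∷_)
import Data.List.Relation.Unary.All.Properties as AllP
open import Data.List.Relation.Unary.Any using (Any; here; there)
open import Data.List.Relation.Unary.AllPairs as AllPairs using (AllPairs; []; _∷_)
import Data.List.Relation.Unary.AllPairs.Properties as AllPairsP
open import Data.List.Relation.Binary.Permutation.Propositional
  using (_↭_; ↭-sym; ↭-trans; ↭-reflexive; ↭⇒↭ₛ)
open import Data.List.Relation.Binary.Permutation.Propositional.Properties
  using (All-resp-↭; ∈-resp-↭; drop-∷; map⁺)
import Data.List.Relation.Binary.Permutation.Setoid.Properties as PermutationSetoid
import Data.List.Relation.Unary.Sorted.TotalOrder.Properties as Sorted
import Data.List.Sort as Sort
open import Data.Sum using (inj₁; inj₂)
open import Data.Product using (Σ; _×_; _,_; proj₁; proj₂; uncurry)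
open import Function using (_∘_)
open import Relation.Binary using (DecTotalOrder; Irreflexive; Asymmetric)
import Relation.Binary.Construct.On as On
open import Relation.Binary.Properties.DecTotalOrder using (≥-decTotalOrder)
open import Relation.Nullary using (yes; no; contradiction)
open import Relation.Binary.PropositionalEquality
  using (_≡_; _≢_; refl; sym; trans; cong; cong₂; subst; setoid; resp₂; module ≡-Reasoning)

open ≡-Reasoning

module Cutting {A : Set} (key : A → ℕ) where

  HeadMinimal : List A → Set
  HeadMinimal []       = ⊥
  HeadMinimal (x ∷ xs) = All (λ y → key x ≤ key y) xs

  headKey : List A → ℕ
  headKey []      = 0
  headKey (x ∷ _) = key x

  Decreasing : List (List A) → Set
  Decreasing = AllPairs (λ s t → headKey t < headKey s)

  -- cutFrom x seg ys: the current segment is x ∷ seg, and ys remains to be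
  -- read; a new segment starts at each y whose key is below that of x.
  cutFrom : A → List A → List A → List (List A)
  cutFrom x seg []       = (x ∷ seg) ∷ []
  cutFrom x seg (y ∷ ys) with key y <? key x
  ... | yes _ = (x ∷ seg) ∷ cutFrom y [] ys
  ... | no  _ = cutFrom x (seg ++ [ y ]) ys

  cut : List A → List (List A)
  cut []       = []
  cut (x ∷ xs) = cutFrom x [] xs

  concat-cutFrom : ∀ x seg ys → concat (cutFrom x seg ys) ≡ x ∷ seg ++ ys
  concat-cutFrom x seg []       = refl
  concat-cutFrom x seg (y ∷ ys) with key y <? key x
  ... | yes _ = cong (λ rest → x ∷ seg ++ rest) (concat-cutFrom y [] ys)
  ... | no  _ = trans (concat-cutFrom x (seg ++ [ y ]) ys) (cong (x ∷_) (++-assoc seg [ y ] ys))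

  concat-cut : ∀ xs → concat (cut xs) ≡ xs
  concat-cut []       = refl
  concat-cut (x ∷ xs) = concat-cutFrom x [] xs

  cutFrom-headMinimal : ∀ x seg ys → All (λ y → key x ≤ key y) seg →
                        All HeadMinimal (cutFrom x seg ys)
  cutFrom-headMinimal x seg []       x≤seg = x≤seg ∷ []
  cutFrom-headMinimal x seg (y ∷ ys) x≤seg with key y <? key x
  ... | yes _   = x≤seg ∷ cutFrom-headMinimal y [] ys []
  ... | no  y≮x = cutFrom-headMinimal x (seg ++ [ y ]) ys (AllP.++⁺ x≤seg (≮⇒≥ y≮x ∷ []))

  cut-headMinimal : ∀ xs → All HeadMinimal (cut xs)
  cut-headMinimal []       = []
  cut-headMinimal (x ∷ xs) = cutFrom-headMinimal x [] xs []

  cutFrom-bounded : ∀ x seg ys → All (λ s → headKey s ≤ key x) (cutFrom x seg ys)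
  cutFrom-bounded x seg []       = ≤-refl ∷ []
  cutFrom-bounded x seg (y ∷ ys) with key y <? key x
  ... | yes y<x = ≤-refl ∷ All.map (λ s≤y → ≤-trans s≤y (<⇒≤ y<x)) (cutFrom-bounded y [] ys)
  ... | no  _   = cutFrom-bounded x (seg ++ [ y ]) ys

  cutFrom-decreasing : ∀ x seg ys → Decreasing (cutFrom x seg ys)
  cutFrom-decreasing x seg []       = [] ∷ []
  cutFrom-decreasing x seg (y ∷ ys) with key y <? key x
  ... | yes y<x = All.map (λ s≤y → ≤-<-trans s≤y y<x) (cutFrom-bounded y [] ys)
                  ∷ cutFrom-decreasing y [] ys
  ... | no  _   = cutFrom-decreasing x (seg ++ [ y ]) ys

  cut-decreasing : ∀ xs → Decreasing (cut xs)
  cut-decreasing []       = []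
  cut-decreasing (x ∷ xs) = cutFrom-decreasing x [] xs

  cutFrom-concat : ∀ x seg rest segs → All (λ y → key x ≤ key y) rest →
                   All HeadMinimal segs → Decreasing segs → All (λ s → headKey s < key x) segs →
                   cutFrom x seg (rest ++ concat segs) ≡ (x ∷ seg ++ rest) ∷ segs
  cutFrom-concat x seg (y ∷ rest) segs (x≤y ∷ x≤rest) minimal decreasing below
    with key y <? key x
  ... | yes y<x = contradiction y<x (≤⇒≯ x≤y)
  ... | no  _   = begin
    cutFrom x (seg ++ [ y ]) (rest ++ concat segs) ≡⟨ cutFrom-concat x (seg ++ [ y ]) rest segs
                                                        x≤rest minimal decreasing below ⟩
    (x ∷ (seg ++ [ y ]) ++ rest) ∷ segs            ≡⟨ cong (λ s → (x ∷ s) ∷ segs) (++-assoc seg [ y ] rest) ⟩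
    (x ∷ seg ++ y ∷ rest) ∷ segs                   ∎
  cutFrom-concat x seg [] [] _ _ _ _ = cong (λ s → (x ∷ s) ∷ []) (sym (++-identityʳ seg))
  cutFrom-concat x seg [] ((y ∷ rest) ∷ segs) [] (y≤rest ∷ minimal) (below-y ∷ decreasing) (y<x ∷ _)
    with key y <? key x
  ... | yes _   = cong₂ _∷_ (cong (x ∷_) (sym (++-identityʳ seg)))
                            (cutFrom-concat y [] rest segs y≤rest minimal decreasing below-y)
  ... | no  y≮x = contradiction y<x y≮x

  cut-concat : ∀ segs → All HeadMinimal segs → Decreasing segs → cut (concat segs) ≡ segs
  cut-concat []                  _                  _                    = refl
  cut-concat ((x ∷ seg) ∷ segs) (x≤seg ∷ minimal) (below ∷ decreasing) =
    cutFrom-concat x [] seg segs x≤seg minimal decreasing below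

strictlySorted-↭-unique : {A : Set} {_≺_ : A → A → Set} → Irreflexive _≡_ _≺_ → Asymmetric _≺_ →
                          ∀ {xs ys} → AllPairs _≺_ xs → AllPairs _≺_ ys → xs ↭ ys → xs ≡ ys
strictlySorted-↭-unique irrefl asym [] [] _ = refl
strictlySorted-↭-unique irrefl asym [] (_ ∷ _) σ with ∈-resp-↭ (↭-sym σ) (here refl)
... | ()
strictlySorted-↭-unique irrefl asym (_ ∷ _) [] σ with ∈-resp-↭ σ (here refl)
... | ()
strictlySorted-↭-unique irrefl asym (x≺xs ∷ xs-sorted) (y≺ys ∷ ys-sorted) σ
  with ∈-resp-↭ σ (here refl) | ∈-resp-↭ (↭-sym σ) (here refl)
... | here refl  | _          =
  cong (_ ∷_) (strictlySorted-↭-unique irrefl asym xs-sorted ys-sorted (drop-∷ σ))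
... | there x∈ys | here refl  = ⊥-elim (irrefl refl (All.lookup y≺ys x∈ys))
... | there x∈ys | there y∈xs = ⊥-elim (asym (All.lookup y≺ys x∈ys) (All.lookup x≺xs y∈xs))

module _ {A : Set} {R : A → A → Set} where

  AllPairs-++⁻ : ∀ xs {ys} → AllPairs R (xs ++ ys) →
                 AllPairs R xs × AllPairs R ys × All (λ x → All (R x) ys) xs
  AllPairs-++⁻ []       Rys              = [] , Rys , []
  AllPairs-++⁻ (x ∷ xs) (Rx ∷ Rxs++ys) with AllPairs-++⁻ xs Rxs++ys
  ... | Rxs , Rys , Rxsys = (AllP.++⁻ˡ xs Rx ∷ Rxs) , Rys , (AllP.++⁻ʳ xs Rx ∷ Rxsys)

  AllPairs-concat⁻ : ∀ xss → AllPairs R (concat xss) →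
                     All (AllPairs R) xss × AllPairs (λ xs ys → All (λ x → All (R x) ys) xs) xss
  AllPairs-concat⁻ []         _ = [] , []
  AllPairs-concat⁻ (xs ∷ xss) R-all with AllPairs-++⁻ xs R-all
  ... | Rxs , Rrest , across with AllPairs-concat⁻ xss Rrest
  ... | within , between = (Rxs ∷ within) , (AllP.All-swap (All.map AllP.concat⁻ across) ∷ between)

-- The least element of a subset of Fin k, as a number: the position of its
-- first element, or k when the subset is empty.
least : ∀ {k} → Subset k → ℕ
least []          = 0
least (true ∷ p)  = 0
least (false ∷ p) = suc (least p)

least-∪ : ∀ {k} (p q : Subset k) → least (p ∪ q) ≡ least p ⊓ least q
least-∪ []          []          = refl
least-∪ (true ∷ p)  (_ ∷ q)     = refl
least-∪ (false ∷ p) (true ∷ q)  = refl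
least-∪ (false ∷ p) (false ∷ q) = cong suc (least-∪ p q)

least-∅ : ∀ k → least (∅ {k}) ≡ k
least-∅ zero    = refl
least-∅ (suc k) = cong suc (least-∅ k)

least≤size : ∀ {k} (p : Subset k) → least p ≤ k
least≤size []          = z≤n
least≤size (true ∷ p)  = z≤n
least≤size (false ∷ p) = s≤s (least≤size p)

least-lower : ∀ {k} {p : Subset k} {x} → x ∈ p → least p ≤ toℕ x
least-lower {p = true ∷ p}  _         = z≤n
least-lower {p = false ∷ p} (there x∈p) = s≤s (least-lower x∈p)

least-attained : ∀ {k} {p : Subset k} → Nonempty p → Σ (Fin k) λ x → x ∈ p × toℕ x ≡ least p
least-attained {p = true ∷ p}  _               = zero , here , refl
least-attained {p = false ∷ p} (_ , there x∈p) with least-attained (_ , x∈p)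
... | y , y∈p , y-least = suc y , there y∈p , cong suc y-least

isMin⇒least : ∀ {k} {p : Subset k} {m} → IsMin p m → toℕ m ≡ least p
isMin⇒least (m∈p , m-min) with least-attained (_ , m∈p)
... | w , w∈p , w-least = ≤-antisym (subst (toℕ _ ≤_) w-least (m-min w w∈p)) (least-lower m∈p)

least⇒isMin : ∀ {k} {p : Subset k} {m} → m ∈ p → toℕ m ≡ least p → IsMin p m
least⇒isMin m∈p m-least = m∈p , λ y y∈p → subst (_≤ toℕ y) (sym m-least) (least-lower y∈p)

module _ {k : ℕ} where

  disjoint⇒¬common : ∀ {A B : Subset k} {x} → Disjoint A B → x ∈ A → x ∈ B → ⊥
  disjoint⇒¬common A∩B≡∅ x∈A x∈B = ∉⊥ (subst (_ ∈_) A∩B≡∅ (x∈p∩q⁺ (x∈A , x∈B)))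

  ¬common⇒disjoint : ∀ {A B : Subset k} → (∀ {x} → x ∈ A → x ∈ B → ⊥) → Disjoint A B
  ¬common⇒disjoint {A} {B} no-common =
    Empty-unique λ (x , x∈A∩B) → uncurry no-common (x∈p∩q⁻ A B x∈A∩B)

  disjoint-sym : ∀ {A B : Subset k} → Disjoint A B → Disjoint B A
  disjoint-sym {A} {B} A∩B≡∅ = trans (∩-comm B A) A∩B≡∅

  disjoint⇒least≢ : ∀ {A B : Subset k} → Nonempty A → Nonempty B → Disjoint A B → least A ≢ least B
  disjoint⇒least≢ {A} {B} A≠∅ B≠∅ A∩B≡∅ eq with least-attained A≠∅ | least-attained B≠∅
  ... | a , a∈A , a-least | b , b∈B , b-least =
    disjoint⇒¬common A∩B≡∅ a∈A (subst (_∈ B) (sym a≡b) b∈B)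
    where
    a≡b : a ≡ b
    a≡b = toℕ-injective (trans a-least (trans eq (sym b-least)))

  ∈⋃⁻ : ∀ {x} (Ts : List (Subset k)) → x ∈ ⋃ Ts → Any (x ∈_) Ts
  ∈⋃⁻ []       x∈∅ = ⊥-elim (∉⊥ x∈∅)
  ∈⋃⁻ (T ∷ Ts) x∈⋃ with x∈p∪q⁻ T (⋃ Ts) x∈⋃
  ... | inj₁ x∈T  = here x∈T
  ... | inj₂ x∈Ts = there (∈⋃⁻ Ts x∈Ts)

  ∈⋃⁺ : ∀ {x} {Ts : List (Subset k)} → Any (x ∈_) Ts → x ∈ ⋃ Ts
  ∈⋃⁺ (here x∈T)   = x∈p∪q⁺ (inj₁ x∈T)
  ∈⋃⁺ (there x∈Ts) = x∈p∪q⁺ (inj₂ (∈⋃⁺ x∈Ts))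

  ⋃-++ : ∀ (Ts Us : List (Subset k)) → ⋃ (Ts ++ Us) ≡ ⋃ Ts ∪ ⋃ Us
  ⋃-++ []       Us = sym (∪-identityˡ (⋃ Us))
  ⋃-++ (T ∷ Ts) Us = trans (cong (T ∪_) (⋃-++ Ts Us)) (sym (∪-assoc T (⋃ Ts) (⋃ Us)))

  ⋃-concat : ∀ (Tss : List (List (Subset k))) → ⋃ (concat Tss) ≡ ⋃ (map ⋃ Tss)
  ⋃-concat []         = refl
  ⋃-concat (Ts ∷ Tss) = trans (⋃-++ Ts (concat Tss)) (cong (⋃ Ts ∪_) (⋃-concat Tss))

  -- ⋃ is a fold of the commutative monoid (∪, ∅), so ignores order.
  ⋃-↭ : ∀ {Ts Us : List (Subset k)} → Ts ↭ Us → ⋃ Ts ≡ ⋃ Us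
  ⋃-↭ σ = PermutationSetoid.foldr-commMonoid (setoid (Subset k)) (∪-isCommutativeMonoid k) (↭⇒↭ₛ σ)

  ⋃-disjoint⁺ : ∀ (Ts Us : List (Subset k)) → All (λ T → All (Disjoint T) Us) Ts → Disjoint (⋃ Ts) (⋃ Us)
  ⋃-disjoint⁺ Ts Us blockwise = ¬common⇒disjoint λ x∈⋃Ts x∈⋃Us →
    let (T-disjoint , x∈T) = All.lookupAny blockwise (∈⋃⁻ Ts x∈⋃Ts) in
    let (T∩U≡∅ , x∈U)      = All.lookupAny T-disjoint (∈⋃⁻ Us x∈⋃Us) in
    disjoint⇒¬common T∩U≡∅ x∈T x∈U

  ⋃-disjoint⁻ : ∀ (Ts Us : List (Subset k)) → Disjoint (⋃ Ts) (⋃ Us) → All (λ T → All (Disjoint T) Us) Ts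
  ⋃-disjoint⁻ Ts Us ⋃-disjoint = All.tabulate λ T∈Ts → All.tabulate λ U∈Us → ¬common⇒disjoint λ x∈T x∈U →
    disjoint⇒¬common ⋃-disjoint (∈⋃⁺ (∈-block T∈Ts x∈T)) (∈⋃⁺ (∈-block U∈Us x∈U))
    where
    ∈-block : ∀ {x T Ts} → T ∈ₗ Ts → x ∈ T → Any (x ∈_) Ts
    ∈-block T∈Ts x∈T = Data.List.Relation.Unary.Any.map (λ { refl → x∈T }) T∈Ts

  least-⋃-lower : ∀ {m} (Ts : List (Subset k)) → m ≤ k → All (λ T → m ≤ least T) Ts → m ≤ least (⋃ Ts)
  least-⋃-lower []       m≤k []          = subst (_ ≤_) (sym (least-∅ k)) m≤k
  least-⋃-lower (T ∷ Ts) m≤k (m≤T ∷ m≤Ts) rewrite least-∪ T (⋃ Ts) = ⊓-glb m≤T (least-⋃-lower Ts m≤k m≤Ts)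

  least-⋃-upper : ∀ (Ts : List (Subset k)) → All (λ T → least (⋃ Ts) ≤ least T) Ts
  least-⋃-upper []       = []
  least-⋃-upper (T ∷ Ts) rewrite least-∪ T (⋃ Ts) =
    m⊓n≤m (least T) (least (⋃ Ts)) ∷ All.map (≤-trans (m⊓n≤n (least T) (least (⋃ Ts)))) (least-⋃-upper Ts)

  -- Ordered set partitions are cut at the blocks whose least element is a
  -- new record.
  open Cutting (least {k}) public

  headKey-least : ∀ {seg} → HeadMinimal seg → headKey seg ≡ least (⋃ seg)
  headKey-least {S ∷ Ts} S≤Ts =
    ≤-antisym (least-⋃-lower (S ∷ Ts) (least≤size S) (≤-refl ∷ S≤Ts)) (All.head (least-⋃-upper (S ∷ Ts)))

  headMinimal⇒firstBlockHasMin : ∀ {seg} → HeadMinimal seg → All Nonempty seg → FirstBlockHasMin seg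
  headMinimal⇒firstBlockHasMin {S ∷ Ts} S≤Ts (S≠∅ ∷ _) m m-min with least-attained S≠∅
  ... | s , s∈S , s-least = subst (_∈ S) (sym m≡s) s∈S
    where
    m≡s : m ≡ s
    m≡s = toℕ-injective (begin
      toℕ m               ≡⟨ isMin⇒least m-min ⟩
      least (⋃ (S ∷ Ts))  ≡⟨ sym (headKey-least {S ∷ Ts} S≤Ts) ⟩
      least S             ≡⟨ sym s-least ⟩
      toℕ s               ∎)

  firstBlockHasMin⇒headMinimal : ∀ {seg} → FirstBlockHasMin seg → Nonempty (⋃ seg) → HeadMinimal seg
  firstBlockHasMin⇒headMinimal {[]}     _     (_ , x∈∅) = ∉⊥ x∈∅
  firstBlockHasMin⇒headMinimal {S ∷ Ts} first ⋃≠∅ with least-attained ⋃≠∅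
  ... | u , u∈⋃ , u-least = All.map (≤-trans S≤⋃) (All.tail (least-⋃-upper (S ∷ Ts)))
    where
    S≤⋃ : least S ≤ least (⋃ (S ∷ Ts))
    S≤⋃ = subst (least S ≤_) u-least (least-lower (first u (least⇒isMin u∈⋃ u-least)))

  headMinimal⇒nonempty : ∀ {seg} → HeadMinimal seg → All Nonempty seg → Nonempty (⋃ seg)
  headMinimal⇒nonempty {S ∷ Ts} _ ((x , x∈S) ∷ _) = x , x∈p∪q⁺ (inj₁ x∈S)

  cut-standardCSP : ∀ {xs} → IsOrderedSetPartition ⊤ xs → IsCompositeSetPartition (cut xs) × IsStandard (cut xs)
  cut-standardCSP {xs} (nonempty , disjoint , covers) =
    (components , nonemptyUnions , disjointUnions , coverage) , standard
    where
    nonempty′ : All (All Nonempty) (cut xs)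
    nonempty′ = AllP.concat⁻ (subst (All Nonempty) (sym (concat-cut xs)) nonempty)
    disjoint′ = AllPairs-concat⁻ (cut xs) (subst (AllPairs Disjoint) (sym (concat-cut xs)) disjoint)
    minimal : All HeadMinimal (cut xs)
    minimal = cut-headMinimal xs
    components : All (λ 𝐒 → IsOrderedSetPartition (⋃ 𝐒) 𝐒) (cut xs)
    components = All.zipWith (λ (ne , dj) → ne , dj , refl) (nonempty′ , proj₁ disjoint′)
    nonemptyUnions : All (λ 𝐒 → Nonempty (⋃ 𝐒)) (cut xs)
    nonemptyUnions = All.zipWith (uncurry headMinimal⇒nonempty) (minimal , nonempty′)
    disjointUnions : AllPairs (λ 𝐒 𝐓 → Disjoint (⋃ 𝐒) (⋃ 𝐓)) (cut xs)
    disjointUnions = AllPairs.map (⋃-disjoint⁺ _ _) (proj₂ disjoint′)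
    coverage : ⋃ (map ⋃ (cut xs)) ≡ ⊤
    coverage = begin
      ⋃ (map ⋃ (cut xs))  ≡⟨ sym (⋃-concat (cut xs)) ⟩
      ⋃ (concat (cut xs)) ≡⟨ cong ⋃ (concat-cut xs) ⟩
      ⋃ xs                ≡⟨ covers ⟩
      ⊤                   ∎
    standard : IsStandard (cut xs)
    standard = All.zipWith (uncurry headMinimal⇒firstBlockHasMin) (minimal , nonempty′)

  CSP-resp-↭ : ∀ {𝐒s 𝐓s} → 𝐒s ↭ 𝐓s → IsCompositeSetPartition 𝐒s → IsCompositeSetPartition 𝐓s
  CSP-resp-↭ σ (components , nonempty , disjoint , covers) =
      All-resp-↭ σ components
    , All-resp-↭ σ nonempty
    , PermutationSetoid.AllPairs-resp-↭ (setoid _) disjoint-sym (resp₂ _) (↭⇒↭ₛ σ) disjoint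
    , trans (sym (⋃-↭ (map⁺ ⋃ σ))) covers

  concat-OSP : ∀ {𝐒s} → IsCompositeSetPartition 𝐒s → IsOrderedSetPartition ⊤ (concat 𝐒s)
  concat-OSP {𝐒s} (components , _ , disjoint , covers) =
      AllP.concat⁺ (All.map proj₁ components)
    , AllPairsP.concat⁺ (All.map (proj₁ ∘ proj₂) components) (AllPairs.map (⋃-disjoint⁻ _ _) disjoint)
    , trans (⋃-concat 𝐒s) covers

  distinctHeadKeys : ∀ {𝐒s} → All (λ 𝐒 → HeadMinimal 𝐒 × Nonempty (⋃ 𝐒)) 𝐒s →
                     AllPairs (λ 𝐒 𝐓 → Disjoint (⋃ 𝐒) (⋃ 𝐓)) 𝐒s → AllPairs (λ 𝐒 𝐓 → headKey 𝐒 ≢ headKey 𝐓) 𝐒s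
  distinctHeadKeys []       []       = []
  distinctHeadKeys (𝐒-ok ∷ oks) (𝐒-disjoint ∷ disjoint) =
    All.zipWith (λ (𝐓-ok , 𝐒∩𝐓≡∅) → differ 𝐒-ok 𝐓-ok 𝐒∩𝐓≡∅) (oks , 𝐒-disjoint) ∷ distinctHeadKeys oks disjoint
    where
    differ : ∀ {𝐒 𝐓} → HeadMinimal 𝐒 × Nonempty (⋃ 𝐒) → HeadMinimal 𝐓 × Nonempty (⋃ 𝐓) →
             Disjoint (⋃ 𝐒) (⋃ 𝐓) → headKey 𝐒 ≢ headKey 𝐓
    differ (𝐒-min , 𝐒≠∅) (𝐓-min , 𝐓≠∅) 𝐒∩𝐓≡∅ eq =
      disjoint⇒least≢ 𝐒≠∅ 𝐓≠∅ 𝐒∩𝐓≡∅ (trans (sym (headKey-least 𝐒-min)) (trans eq (headKey-least 𝐓-min)))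

  byHeadKey : DecTotalOrder _ _ _
  byHeadKey = On.decTotalOrder (≥-decTotalOrder ≤-decTotalOrder) headKey

  open Sort byHeadKey using (sort; sort-↭; sort-↗)

  -- Every standard composite set partition is, up to the order of its
  -- components, the cutting of an ordered set partition: the concatenation
  -- of its components sorted by decreasing head key.
  cut-surjective : (𝐒 : SCSP k) → Σ (OSP k) λ π → cut (proj₁ π) ↭ proj₁ 𝐒
  cut-surjective (𝐒s , csp , standard) =
    (concat (sort 𝐒s) , concat-OSP csp′) , ↭-trans (↭-reflexive (cut-concat (sort 𝐒s) minimal decreasing)) (sort-↭ 𝐒s)
    where
    csp′ : IsCompositeSetPartition (sort 𝐒s)
    csp′ = CSP-resp-↭ (↭-sym (sort-↭ 𝐒s)) csp
    minimal : All HeadMinimal (sort 𝐒s)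
    minimal = All.zipWith (uncurry firstBlockHasMin⇒headMinimal)
                          (All-resp-↭ (↭-sym (sort-↭ 𝐒s)) standard , proj₁ (proj₂ csp′))
    decreasing : Decreasing (sort 𝐒s)
    decreasing = AllPairs.zipWith (λ (≥ , ≢) → ≤∧≢⇒< ≥ (≢ ∘ sym))
      ( Sorted.Sorted⇒AllPairs (DecTotalOrder.totalOrder byHeadKey) (sort-↗ 𝐒s)
      , distinctHeadKeys (All.zip (minimal , proj₁ (proj₂ csp′))) (proj₁ (proj₂ (proj₂ csp′))))

  -- Cutting is injective: the segments determine the list, and their order
  -- is forced by the decreasing head keys.
  cut-injective : ∀ {xs ys} → cut xs ↭ cut ys → xs ≡ ys
  cut-injective {xs} {ys} σ = begin
    xs               ≡⟨ sym (concat-cut xs) ⟩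
    concat (cut xs)  ≡⟨ cong concat (strictlySorted-↭-unique (λ { refl → <-irrefl refl }) <-asym
                                       (cut-decreasing xs) (cut-decreasing ys) σ) ⟩
    concat (cut ys)  ≡⟨ concat-cut ys ⟩
    ys               ∎

lemma4p3 : (n : ℕ) → 1 ≤ n → Bijection (OSP-setoid n) (SCSP-setoid n)
lemma4p3 n _ = record
  { to        = λ (xs , osp) → cut xs , cut-standardCSP osp
  ; cong      = λ xs≡ys → ↭-reflexive (cong cut xs≡ys)
  ; bijective = cut-injective , surjective
  }
  where
  surjective : (𝐒 : SCSP n) → Σ (OSP n) λ π → ∀ {π′ : OSP n} → proj₁ π′ ≡ proj₁ π → cut (proj₁ π′) ↭ proj₁ 𝐒
  surjective 𝐒 = let (π , cut-π↭𝐒) = cut-surjective 𝐒 in π , λ { refl → cut-π↭𝐒 }
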